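{- Let $\mathbb{K}=(G,M,I)$ be a formal context and let $\mathbb{S}$ be a Boolean subcontext of dimension $k$ of $\mathbb{K}$ which is also a closed-subcontext of $\mathbb{K}$. Then $\underline{S}:=\phi_1(\mathbb{S})=\phi_2(\mathbb{S})$ is a Boolean sublattice of dimension $k$ of $\underline{\mathfrak{B}}(\mathbb{K})$.
   Context: All sets are finite. A formal context $\mathbb{K}=(G,M,I)$ has finite $G$, $M$, $I\subseteq G\times M$; for $A\subseteq G$, $A'$ is the set of attributes common to all objects of $A$, for $B\subseteq M$, $B'$ the set of objects having all attributes of $B$. Formal concepts $(A,B)$ satisfy $A'=B$, $B'=A$ and form the concept lattice $\underline{\mathfrak{B}}(\mathbb{K})$ ordered by extent inclusion. $\mathfrak{B}(k)$ is the concept lattice of the contranominal scale $(\{1,\dots,k\},\{1,\dots,k\},\ne)$. For $H\subseteq G$, $N\subseteq M$, $[H,N]=(H,N,I\cap(H\times N))$ with concepts computed w.r.t. its own incidence; it is a Boolean subcontext of dimension $k$ if its concept lattice is isomorphic to $\mathfrak{B}(k)$. A formal context $(H,N,J)$ is a closed-subcontext of $\mathbb{K}$ iff $H\subseteq G$, $N\subseteq M$, $J\subseteq I\cap(H\times N)$, and every concept of $(H,N,J)$ is a concept of $\mathbb{K}$. For a concept $(A,B)$ of $\mathbb{S}=[H,N]$, $\phi_1(A,B)=(A'',A')$, $\phi_2(A,B)=(B',B'')$ (derivations in $\mathbb{K}$), and $\phi_i(\mathbb{S})=\{\phi_i(C)\mid C\text{ a concept of }\mathbb{S}\}$ with the induced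 order. A Boolean sublattice of dimension $k$ of $\underline{\mathfrak{B}}(\mathbb{K})$ is a subset closed under binary joins and meets of $\underline{\mathfrak{B}}(\mathbb{K})$ which with the induced order is isomorphic to $\mathfrak{B}(k)$. -}

module Defs where

open import Data.Nat using (ℕ)
open import Data.Bool using (Bool; true; false; _∧_; _∨_; not)
open import Data.Fin using (Fin; zero; suc)
open import Data.Fin.Properties using (_≟_)
open import Data.Fin.Subset using (Subset; _⊆_; ⊤)
open import Data.Vec using (lookup; tabulate)
open import Data.Product using (Σ; _×_; _,_; proj₁; proj₂; ∃)
open import Relation.Nullary.Decidable using (⌊_⌋)
open import Relation.Binary.PropositionalEquality using (_≡_)
open import Function.Bundles using (_⇔_)

-- A finite formal context (G, M, I) with G = Fin g, M = Fin m and
-- incidence I given as a Boolean-valued relation (i I j iff I i j ≡ true).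
record Context : Set where
  constructor context
  field
    g : ℕ
    m : ℕ
    I : Fin g → Fin m → Bool
open Context public

allᶠ : (n : ℕ) → (Fin n → Bool) → Bool
allᶠ ℕ.zero    p = true
allᶠ (ℕ.suc n) p = p zero ∧ allᶠ n (λ i → p (suc i))

-- Derivation operators of the context (H, N, J), where H ⊆ Fin g, N ⊆ Fin m
-- and J is an incidence on Fin g × Fin m (only its restriction to H × N matters).
up : {g m : ℕ} → (Fin g → Fin m → Bool) → Subset m → Subset g → Subset m
up {g} J N A = tabulate λ j → lookup N j ∧ allᶠ g (λ i → not (lookup A i) ∨ J i j)

down : {g m : ℕ} → (Fin g → Fin m → Bool) → Subset g → Subset m → Subset g
down {g} {m} J H B = tabulate λ i → lookup H i ∧ allᶠ m (λ j → not (lookup B j) ∨ J i j)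

IsConceptOf : {g m : ℕ} → Subset g → Subset m → (Fin g → Fin m → Bool) →
              Subset g × Subset m → Set
IsConceptOf H N J (A , B) = A ⊆ H × B ⊆ N × up J N A ≡ B × down J H B ≡ A

ConceptOf : {g m : ℕ} → Subset g → Subset m → (Fin g → Fin m → Bool) → Set
ConceptOf {g} {m} H N J = Σ (Subset g × Subset m) (IsConceptOf H N J)

_′ᴳ : (K : Context) → Subset (g K) → Subset (m K)
(K ′ᴳ) A = up (I K) ⊤ A

_′ᴹ : (K : Context) → Subset (m K) → Subset (g K)
(K ′ᴹ) B = down (I K) ⊤ B

Concept : Context → Set
Concept K = ConceptOf ⊤ ⊤ (I K)

extent : {g m : ℕ} {H : Subset g} {N : Subset m} {J : Fin g → Fin m → Bool} →
         ConceptOf H N J → Subset g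
extent c = proj₁ (proj₁ c)

intent : {g m : ℕ} {H : Subset g} {N : Subset m} {J : Fin g → Fin m → Bool} →
         ConceptOf H N J → Subset m
intent c = proj₂ (proj₁ c)

restrict : (K : Context) → Subset (g K) → Subset (m K) → Fin (g K) → Fin (m K) → Bool
restrict K H N i j = lookup H i ∧ lookup N j ∧ I K i j

SubConcept : (K : Context) → Subset (g K) → Subset (m K) → Set
SubConcept K H N = ConceptOf H N (restrict K H N)

record OrderIso {C D : Set}
                (_≈C_ : C → C → Set) (_≤C_ : C → C → Set)
                (_≈D_ : D → D → Set) (_≤D_ : D → D → Set) : Set where
  field
    to       : C → D
    from     : D → C
    to-from  : ∀ y → to (from y) ≈D y
    from-to  : ∀ x → from (to x) ≈C x
    to-order : ∀ x y → (x ≤C y) ⇔ (to x ≤D to y)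

contranominal : ℕ → Context
contranominal k = context k k (λ i j → not ⌊ i ≟ j ⌋)

_≈ᶜ_ : {g m : ℕ} {H : Subset g} {N : Subset m} {J : Fin g → Fin m → Bool} →
       ConceptOf H N J → ConceptOf H N J → Set
c ≈ᶜ d = proj₁ c ≡ proj₁ d

_≤ᶜ_ : {g m : ℕ} {H : Subset g} {N : Subset m} {J : Fin g → Fin m → Bool} →
       ConceptOf H N J → ConceptOf H N J → Set
c ≤ᶜ d = extent c ⊆ extent d

𝔅 : ℕ → Set
𝔅 k = Concept (contranominal k)

IsBooleanSubcontext : (K : Context) → Subset (g K) → Subset (m K) → ℕ → Set
IsBooleanSubcontext K H N k =
  OrderIso {SubConcept K H N} {𝔅 k} _≈ᶜ_ _≤ᶜ_ _≈ᶜ_ _≤ᶜ_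

IsClosedSubcontext : (K : Context) → Subset (g K) → Subset (m K) →
                     (Fin (g K) → Fin (m K) → Bool) → Set
IsClosedSubcontext K H N J =
  (∀ i j → J i j ≡ true → restrict K H N i j ≡ true) ×
  (∀ (c : ConceptOf H N J) → IsConceptOf ⊤ ⊤ (I K) (proj₁ c))

φ₁ : (K : Context) → Subset (g K) × Subset (m K) → Subset (g K) × Subset (m K)
φ₁ K (A , B) = ((K ′ᴹ) ((K ′ᴳ) A) , (K ′ᴳ) A)

φ₂ : (K : Context) → Subset (g K) × Subset (m K) → Subset (g K) × Subset (m K)
φ₂ K (A , B) = ((K ′ᴹ) B , (K ′ᴳ) ((K ′ᴹ) B))

φ₁-image : (K : Context) (H : Subset (g K)) (N : Subset (m K)) → Concept K → Set
φ₁-image K H N c = ∃ λ (s : SubConcept K H N) → φ₁ K (proj₁ s) ≡ proj₁ c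

φ₂-image : (K : Context) (H : Subset (g K)) (N : Subset (m K)) → Concept K → Set
φ₂-image K H N c = ∃ λ (s : SubConcept K H N) → φ₂ K (proj₁ s) ≡ proj₁ c

IsJoin : (K : Context) → Concept K → Concept K → Concept K → Set
IsJoin K x y z = x ≤ᶜ z × y ≤ᶜ z × (∀ (w : Concept K) → x ≤ᶜ w → y ≤ᶜ w → z ≤ᶜ w)

IsMeet : (K : Context) → Concept K → Concept K → Concept K → Set
IsMeet K x y z = z ≤ᶜ x × z ≤ᶜ y × (∀ (w : Concept K) → w ≤ᶜ x → w ≤ᶜ y → w ≤ᶜ z)

Sub : (K : Context) → (Concept K → Set) → Set
Sub K P = Σ (Concept K) P

_≈ˢ_ : {K : Context} {P : Concept K → Set} → Sub K P → Sub K P → Set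
x ≈ˢ y = proj₁ x ≈ᶜ proj₁ y

_≤ˢ_ : {K : Context} {P : Concept K → Set} → Sub K P → Sub K P → Set
x ≤ˢ y = proj₁ x ≤ᶜ proj₁ y

IsBooleanSublattice : (K : Context) → (Concept K → Set) → ℕ → Set
IsBooleanSublattice K P k =
  (∀ x y z → P x → P y → IsJoin K x y z → P z) ×
  (∀ x y z → P x → P y → IsMeet K x y z → P z) ×
  OrderIso {Sub K P} {𝔅 k} _≈ˢ_ _≤ˢ_ _≈ᶜ_ _≤ᶜ_

-- The closure hypothesis says that every concept of 𝕊 = [H, N] already is a
-- concept of 𝕂, so φ₁ and φ₂ both fix it and their images are exactly the
-- concepts of 𝕂 that are concepts of 𝕊; in particular the order isomorphism
-- 𝔅(𝕊) ≅ 𝔅(k) carries over to φ₁(𝕊). For closure under joins, the join of two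
-- such concepts with intents B₁, B₂ is the 𝕊-concept generated by B₁ ∩ B₂: it
-- is an upper bound in 𝕂, and its intent contains B₁ ∩ B₂, which contains the
-- intent of every upper bound. Meets are dual, via the 𝕊-concept generated by
-- the intersection of the extents.
module Submission where

open import Defs
open import Data.Nat using (ℕ; zero; suc)
open import Data.Bool using (Bool; true; false; _∧_; _∨_; not)
open import Data.Bool.Properties using (∧-conicalˡ; ∧-conicalʳ)
open import Data.Fin using (Fin)
open import Data.Fin.Subset using (Subset; _⊆_; _∈_; ⊤; _∩_)
open import Data.Fin.Subset.Properties
  using (⊆-antisym; ⊆-trans; ⊆-reflexive; p∩q⊆p; p∩q⊆q; x∈p∩q⁺)
open import Data.Vec using (lookup; tabulate)
open import Data.Vec.Properties using ([]=⇒lookup; lookup⇒[]=; lookup∘tabulate)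
open import Data.Product using (_×_; _,_; proj₁; proj₂)
open import Function using (flip)
open import Function.Bundles using (_⇔_; mk⇔; Equivalence)
open import Relation.Binary.PropositionalEquality
  using (_≡_; refl; sym; trans; cong; cong₂; subst; subst₂)

∧-true : ∀ {a b} → a ≡ true → b ≡ true → a ∧ b ≡ true
∧-true refl refl = refl

not∨-true⁻ : ∀ {a b} → not a ∨ b ≡ true → a ≡ true → b ≡ true
not∨-true⁻ h refl = h

not∨-true⁺ : ∀ {a b} → (a ≡ true → b ≡ true) → not a ∨ b ≡ true
not∨-true⁺ {false} _ = refl
not∨-true⁺ {true}  f = f refl

allᶠ-true⁻ : ∀ {n} {p : Fin n → Bool} → allᶠ n p ≡ true → ∀ i → p i ≡ true
allᶠ-true⁻ h Fin.zero = ∧-conicalˡ _ _ h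
allᶠ-true⁻ {p = p} h (Fin.suc i) = allᶠ-true⁻ (∧-conicalʳ (p Fin.zero) _ h) i

allᶠ-true⁺ : ∀ {n} {p : Fin n → Bool} → (∀ i → p i ≡ true) → allᶠ n p ≡ true
allᶠ-true⁺ {zero}  h = refl
allᶠ-true⁺ {suc n} h = ∧-true (h Fin.zero) (allᶠ-true⁺ (λ i → h (Fin.suc i)))

∈-tabulate⁻ : ∀ {n} {f : Fin n → Bool} {i} → i ∈ tabulate f → f i ≡ true
∈-tabulate⁻ {f = f} {i} h = trans (sym (lookup∘tabulate f i)) ([]=⇒lookup h)

∈-tabulate⁺ : ∀ {n} {f : Fin n → Bool} {i} → f i ≡ true → i ∈ tabulate f
∈-tabulate⁺ {f = f} {i} h = lookup⇒[]= i (tabulate f) (trans (lookup∘tabulate f i) h)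

-- Both derivation operators are instances of down: up J N ≡ down (flip J) N
-- definitionally, so every lemma about down also yields its dual about up.
module _ {g m : ℕ} (J : Fin g → Fin m → Bool) (H : Subset g) where

  ∈-down⁻ : ∀ {B i} → i ∈ down J H B → i ∈ H × (∀ {j} → j ∈ B → J i j ≡ true)
  ∈-down⁻ {i = i} h =
      lookup⇒[]= i H (∧-conicalˡ _ _ i∈)
    , λ {j} j∈B → not∨-true⁻ (allᶠ-true⁻ (∧-conicalʳ (lookup H i) _ i∈) j) ([]=⇒lookup j∈B)
    where i∈ = ∈-tabulate⁻ h

  ∈-down⁺ : ∀ {B i} → i ∈ H → (∀ {j} → j ∈ B → J i j ≡ true) → i ∈ down J H B
  ∈-down⁺ {B} i∈H f = ∈-tabulate⁺
    (∧-true ([]=⇒lookup i∈H) (allᶠ-true⁺ λ j → not∨-true⁺ λ j∈B → f (lookup⇒[]= j B j∈B)))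

  down-⊆ : ∀ B → down J H B ⊆ H
  down-⊆ B h = proj₁ (∈-down⁻ {B} h)

  down-antitone : ∀ {B B′} → B ⊆ B′ → down J H B′ ⊆ down J H B
  down-antitone {B} {B′} B⊆B′ h =
    ∈-down⁺ {B} (down-⊆ B′ h) λ j∈B → proj₂ (∈-down⁻ {B′} h) (B⊆B′ j∈B)

module _ {g m : ℕ} (J : Fin g → Fin m → Bool) (H : Subset g) (N : Subset m) where

  ⊆-down-up : ∀ {A} → A ⊆ H → A ⊆ down J H (up J N A)
  ⊆-down-up A⊆H i∈A = ∈-down⁺ J H (A⊆H i∈A) λ j∈ → proj₂ (∈-down⁻ (flip J) N j∈) i∈A

module _ {g m : ℕ} (J : Fin g → Fin m → Bool) (H : Subset g) (N : Subset m) where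

  down-up-down : ∀ {B} → B ⊆ N → down J H (up J N (down J H B)) ≡ down J H B
  down-up-down {B} B⊆N = ⊆-antisym
    (down-antitone J H (⊆-down-up (flip J) N H B⊆N))
    (⊆-down-up J H N (down-⊆ J H B))

module Concepts {g m : ℕ} (J : Fin g → Fin m → Bool) (H : Subset g) (N : Subset m) where

  conceptOfIntent : (D : Subset m) → D ⊆ N → ConceptOf H N J
  conceptOfIntent D D⊆N =
    (down J H D , up J N (down J H D)) ,
    down-⊆ J H D , down-⊆ (flip J) N (down J H D) , refl , down-up-down J H N D⊆N

  conceptOfExtent : (C : Subset g) → C ⊆ H → ConceptOf H N J
  conceptOfExtent C C⊆H =
    (down J H (up J N C) , up J N C) ,
    down-⊆ J H (up J N C) , down-⊆ (flip J) N C , down-up-down (flip J) N H C⊆H , refl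

  extent-⊆-down : ∀ (c : ConceptOf H N J) {D} → D ⊆ intent c → extent c ⊆ down J H D
  extent-⊆-down (_ , _ , _ , _ , down≡A) D⊆B =
    ⊆-trans (⊆-reflexive (sym down≡A)) (down-antitone J H D⊆B)

  intent-⊆-up : ∀ (c : ConceptOf H N J) {C} → C ⊆ extent c → intent c ⊆ up J N C
  intent-⊆-up (_ , _ , _ , up≡B , _) C⊆A =
    ⊆-trans (⊆-reflexive (sym up≡B)) (down-antitone (flip J) N C⊆A)

  ≤ᶜ⇒⊇ : ∀ (c d : ConceptOf H N J) → c ≤ᶜ d → intent d ⊆ intent c
  ≤ᶜ⇒⊇ c@(_ , _ , _ , up≡B , _) d c≤d =
    ⊆-trans (intent-⊆-up d {extent c} c≤d) (⊆-reflexive up≡B)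

  ⊇⇒≤ᶜ : ∀ (c d : ConceptOf H N J) → intent d ⊆ intent c → c ≤ᶜ d
  ⊇⇒≤ᶜ c d@(_ , _ , _ , _ , down≡A) d⊆c =
    ⊆-trans (extent-⊆-down c {intent d} d⊆c) (⊆-reflexive down≡A)

  ≈ᶜ-from-extent : ∀ (c d : ConceptOf H N J) → extent c ≡ extent d → c ≈ᶜ d
  ≈ᶜ-from-extent ((A , _) , _ , _ , up≡B , _) (_ , _ , _ , up≡B′ , _) refl =
    cong (A ,_) (trans (sym up≡B) up≡B′)

φ₁-fixes-concept : ∀ (K : Context) {p} → IsConceptOf ⊤ ⊤ (I K) p → φ₁ K p ≡ p
φ₁-fixes-concept K (_ , _ , up≡B , down≡A) = cong₂ _,_ (trans (cong (K ′ᴹ) up≡B) down≡A) up≡B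

φ₂-fixes-concept : ∀ (K : Context) {p} → IsConceptOf ⊤ ⊤ (I K) p → φ₂ K p ≡ p
φ₂-fixes-concept K (_ , _ , up≡B , down≡A) = cong₂ _,_ down≡A (trans (cong (K ′ᴳ) down≡A) up≡B)

module ClosedSubcontext (K : Context) (H : Subset (g K)) (N : Subset (m K))
  (closed : ∀ (s : SubConcept K H N) → IsConceptOf ⊤ ⊤ (I K) (proj₁ s)) where

  private
    J = restrict K H N
    module S = Concepts J H N
    module 𝕂 = Concepts (I K) ⊤ ⊤

  embed : SubConcept K H N → Concept K
  embed s = proj₁ s , closed s

  φ₁-image-pair : ∀ c (x : φ₁-image K H N c) → proj₁ (proj₁ x) ≡ proj₁ c
  φ₁-image-pair _ (s , e) = trans (sym (φ₁-fixes-concept K (closed s))) e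

  φ₁-image⇔φ₂-image : ∀ (c : Concept K) → φ₁-image K H N c ⇔ φ₂-image K H N c
  φ₁-image⇔φ₂-image c = mk⇔
    (λ { (s , e) → s , trans (φ₂-fixes-concept K (closed s)) (φ₁-image-pair c (s , e)) })
    (λ { (s , e) → s , trans (φ₁-fixes-concept K (closed s))
                              (trans (sym (φ₂-fixes-concept K (closed s))) e) })

  φ₁-image⇔subconcept : ∀ (c : Concept K) → φ₁-image K H N c ⇔ IsConceptOf H N J (proj₁ c)
  φ₁-image⇔subconcept c = mk⇔
    (λ x → subst (IsConceptOf H N J) (φ₁-image-pair c x) (proj₂ (proj₁ x)))
    (λ c∈S → (proj₁ c , c∈S) , φ₁-fixes-concept K (proj₂ c))

  join-closed : ∀ x y z → IsConceptOf H N J (proj₁ x) → IsConceptOf H N J (proj₁ y) →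
                IsJoin K x y z → IsConceptOf H N J (proj₁ z)
  join-closed x y z x∈S y∈S (x≤z , y≤z , least) =
    subst (IsConceptOf H N J) (𝕂.≈ᶜ-from-extent (embed t) z (⊆-antisym t≤z z≤t)) (proj₂ t)
    where
    sx sy : ConceptOf H N J
    sx = proj₁ x , x∈S
    sy = proj₁ y , y∈S
    D = intent sx ∩ intent sy
    D⊆N : D ⊆ N
    D⊆N = ⊆-trans (p∩q⊆p (intent sx) (intent sy)) (proj₁ (proj₂ x∈S))
    t = S.conceptOfIntent D D⊆N
    z≤t : z ≤ᶜ embed t
    z≤t = least (embed t)
      (S.extent-⊆-down sx (p∩q⊆p (intent sx) (intent sy)))
      (S.extent-⊆-down sy (p∩q⊆q (intent sx) (intent sy)))
    z⊆D : intent z ⊆ D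
    z⊆D j∈ = x∈p∩q⁺ (𝕂.≤ᶜ⇒⊇ x z x≤z j∈ , 𝕂.≤ᶜ⇒⊇ y z y≤z j∈)
    t≤z : embed t ≤ᶜ z
    t≤z = 𝕂.⊇⇒≤ᶜ (embed t) z (⊆-trans z⊆D (⊆-down-up (flip J) N H D⊆N))

  meet-closed : ∀ x y z → IsConceptOf H N J (proj₁ x) → IsConceptOf H N J (proj₁ y) →
                IsMeet K x y z → IsConceptOf H N J (proj₁ z)
  meet-closed x y z x∈S y∈S (z≤x , z≤y , greatest) =
    subst (IsConceptOf H N J) (𝕂.≈ᶜ-from-extent (embed t) z (⊆-antisym t≤z z≤t)) (proj₂ t)
    where
    sx sy : ConceptOf H N J
    sx = proj₁ x , x∈S
    sy = proj₁ y , y∈S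
    C = extent sx ∩ extent sy
    C⊆H : C ⊆ H
    C⊆H = ⊆-trans (p∩q⊆p (extent sx) (extent sy)) (proj₁ x∈S)
    t = S.conceptOfExtent C C⊆H
    t≤z : embed t ≤ᶜ z
    t≤z = greatest (embed t)
      (S.⊇⇒≤ᶜ t sx (S.intent-⊆-up sx (p∩q⊆p (extent sx) (extent sy))))
      (S.⊇⇒≤ᶜ t sy (S.intent-⊆-up sy (p∩q⊆q (extent sx) (extent sy))))
    z≤t : z ≤ᶜ embed t
    z≤t i∈ = ⊆-down-up J H N C⊆H (x∈p∩q⁺ (z≤x i∈ , z≤y i∈))

  φ₁-image-iso : ∀ {k} → IsBooleanSubcontext K H N k →
                 OrderIso {Sub K (φ₁-image K H N)} {𝔅 k} _≈ˢ_ _≤ˢ_ _≈ᶜ_ _≤ᶜ_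
  φ₁-image-iso iso = record
    { to       = λ x → O.to (proj₁ (proj₂ x))
    ; from     = λ d → embed (O.from d) , O.from d , φ₁-fixes-concept K (closed (O.from d))
    ; to-from  = O.to-from
    ; from-to  = λ x → trans (O.from-to (proj₁ (proj₂ x))) (φ₁-image-pair (proj₁ x) (proj₂ x))
    ; to-order = λ x y → subst₂ (λ A A′ → (A ⊆ A′) ⇔ _)
                           (cong proj₁ (φ₁-image-pair (proj₁ x) (proj₂ x)))
                           (cong proj₁ (φ₁-image-pair (proj₁ y) (proj₂ y)))
                           (O.to-order (proj₁ (proj₂ x)) (proj₁ (proj₂ y)))
    }
    where module O = OrderIso iso

lemma19 : (K : Context) (H : Subset (g K)) (N : Subset (m K)) (k : ℕ) →
          IsBooleanSubcontext K H N k →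
          IsClosedSubcontext K H N (restrict K H N) →
          (∀ (c : Concept K) → φ₁-image K H N c ⇔ φ₂-image K H N c) ×
          IsBooleanSublattice K (φ₁-image K H N) k
lemma19 K H N k boolean (_ , closed) =
  φ₁-image⇔φ₂-image ,
  (λ x y z x∈ y∈ join → fromS z (join-closed x y z (toS x x∈) (toS y y∈) join)) ,
  (λ x y z x∈ y∈ meet → fromS z (meet-closed x y z (toS x x∈) (toS y y∈) meet)) ,
  φ₁-image-iso boolean
  where
  open ClosedSubcontext K H N closed
  toS : ∀ c → φ₁-image K H N c → IsConceptOf H N (restrict K H N) (proj₁ c)
  toS c = Equivalence.to (φ₁-image⇔subconcept c)
  fromS : ∀ c → IsConceptOf H N (restrict K H N) (proj₁ c) → φ₁-image K H N c
  fromS c = Equivalence.from (φ₁-image⇔subconcept c)
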